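{- Let $G=\Theta(l_1,\ldots,l_n)$ with end vertices $u,w$, and let $\mathcal{H}=(L,H)$ be a full $m$-fold cover of $G$ where $m\ge 2$, with $L(v)=\{(v,j):j\in[m]\}$ for each $v$. Let $(i,j)\in[m]^2$ and $k\in[n]$. If there is a path in $H_k$ connecting $(u,i)$ and $(w,j)$ consisting only of cross-edges of $\mathcal{H}_k$, then $$N(\{(u,i),(w,j)\},\mathcal{H}_k)=\frac{(m-1)^{l_k}+(-1)^{l_k}(m-1)}{m};$$ otherwise $$N(\{(u,i),(w,j)\},\mathcal{H}_k)=\frac{(m-1)^{l_k}-(-1)^{l_k}}{m}.$$
   Context: $\Theta(l_1,\ldots,l_n)$ consists of two end vertices $u,w$ joined by $n\ge 2$ internally disjoint paths $G_1,\ldots,G_n$ of lengths $l_1,\ldots,l_n$, where $l_1=\min_i l_i\ge 1$ and $l_i\ge 2$ for $i\ge 2$; let $R_k=V(G_k)$. A cover of a graph $G$ is a pair $\mathcal{H}=(L,H)$ with $H$ a graph and $L:V(G)\to\mathcal{P}(V(H))$ such that: (1) $\{L(v)\}$ partitions $V(H)$ into $|V(G)|$ parts; (2) $H[L(v)]$ is complete; (3) if $H$ has an edge between $L(v)$ and $L(v')$, $v\neq v'$, then $vv'\in E(G)$; (4) if $vv'\in E(G)$, the edges of $H$ between $L(v)$ and $L(v')$ form a matching. Edges of a cover graph joining distinct parts are cross-edges. An $\mathcal{H}$-coloring is an independent set of $H$ of size $|V(G)|$. $\mathcal{H}$ is a full $m$-fold cover if $|L(v)|=m$ for all $v$ and every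 such matching for an edge of $G$ is perfect. For $k\in[n]$, $\mathcal{H}_k=(L_k,H_k)$ where $L_k$ is $L$ restricted to $R_k$, and $H_k=H[\bigcup_{v\in R_k}L(v)]$ minus the edges of $H$ between $L(u)$ and $L(w)$ if $l_1=1$ and $k\ne 1$, and $H_k=H[\bigcup_{v\in R_k}L(v)]$ otherwise; $\mathcal{H}_k$ is a full $m$-fold cover of the path $G_k$. $N(P,\mathcal{H}_k)$ is the number of $\mathcal{H}_k$-colorings of $G_k$ containing the vertex set $P$. -}

module Defs where

open import Data.Nat as ℕ using (ℕ; zero; suc; _<_; _≤_; _∸_; _<?_; _≡ᵇ_)
open import Data.Fin as Fin using (Fin; fromℕ<; fromℕ; toℕ; combine; remQuot)
open import Data.Fin.Subset using (Subset; ∣_∣)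
open import Data.Vec using (Vec; []; _∷_; lookup)
open import Data.Bool using (Bool; true; false; not; _∧_; _∨_; if_then_else_)
open import Data.Product using (Σ; Σ-syntax; _×_; _,_; proj₁)
open import Data.Sum using (_⊎_)
open import Data.List using (List; _∷_; _∷ʳ_)
open import Data.List.Relation.Unary.Linked using (Linked)
open import Data.List.Relation.Unary.Unique.Propositional using (Unique)
open import Relation.Binary.PropositionalEquality using (_≡_; _≢_)
open import Relation.Nullary using (yes; no)

-- Paths are indexed by Fin (suc n) (so there are
-- suc n ≥ 2 paths when n ≥ 1); index `Fin.zero` plays the role of G₁.
-- Vertices: the end vertices u, w and the internal vertices of each path;
-- `int k t` is the vertex at position (suc (toℕ t)) on path k,
-- for positions 1 … l k − 1.

data ThetaV (n : ℕ) (l : Fin (suc n) → ℕ) : Set where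
  u : ThetaV n l
  w : ThetaV n l
  int : (k : Fin (suc n)) → Fin (l k ∸ 1) → ThetaV n l

pos : ∀ {n l} (k : Fin (suc n)) → ℕ → ThetaV n l
pos k zero = u
pos {l = l} k (suc t) with t <? (l k ∸ 1)
... | yes p = int k (fromℕ< p)
... | no _  = w

ThetaEdge : ∀ {n l} → ThetaV n l → ThetaV n l → Set
ThetaEdge {n} {l} v v' =
  Σ[ k ∈ Fin (suc n) ] Σ[ t ∈ ℕ ] (t < l k ×
    ((v ≡ pos k t × v' ≡ pos k (suc t)) ⊎ (v ≡ pos k (suc t) × v' ≡ pos k t)))

-- Full m-fold covers of a graph (V, E) with L(v) = {(v,j) : j ∈ [m]}.
-- The cover graph H has vertex set V × Fin m and (simple, loopless)
-- Bool-valued adjacency `adj`.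

record FullCover (V : Set) (E : V → V → Set) (m : ℕ) : Set where
  field
    adj       : V × Fin m → V × Fin m → Bool
    adj-sym   : ∀ x y → adj x y ≡ adj y x
    adj-irr   : ∀ x → adj x x ≡ false
    clique    : ∀ v a b → a ≢ b → adj (v , a) (v , b) ≡ true
    cross⇒E   : ∀ v v' a b → v ≢ v' → adj (v , a) (v' , b) ≡ true → E v v'
    matching  : ∀ v v' a b b' → E v v' → v ≢ v' →
                adj (v , a) (v' , b) ≡ true → adj (v , a) (v' , b') ≡ true → b ≡ b'
    perfect   : ∀ v v' → E v v' → v ≢ v' → ∀ a → Σ[ b ∈ Fin m ] adj (v , a) (v' , b) ≡ true

-- The cover H_k of the path G_k.  Its vertex set ⋃_{v ∈ R_k} L(v) is
-- indexed by (position t on G_k , colour j), standing for (pos k t , j).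

isU isW : ∀ {n l} → ThetaV n l → Bool
isU u = true
isU _ = false
isW w = true
isW _ = false

isFirst : ∀ {n} → Fin (suc n) → Bool
isFirst Fin.zero = true
isFirst (Fin.suc _) = false

HkV : ∀ {n} (l : Fin (suc n) → ℕ) (k : Fin (suc n)) (m : ℕ) → Set
HkV l k m = Fin (suc (l k)) × Fin m

module _ {n : ℕ} {l : Fin (suc n) → ℕ} {m : ℕ}
         (H : FullCover (ThetaV n l) ThetaEdge m) (k : Fin (suc n)) where
  open FullCover H

  vtx : HkV l k m → ThetaV n l × Fin m
  vtx (t , a) = (pos k (toℕ t) , a)

  removed : HkV l k m → HkV l k m → Bool
  removed (t , _) (t' , _) =
    (l Fin.zero ≡ᵇ 1) ∧ not (isFirst k) ∧
    ((isU (pos {l = l} k (toℕ t)) ∧ isW (pos {l = l} k (toℕ t'))) ∨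
     (isW (pos {l = l} k (toℕ t)) ∧ isU (pos {l = l} k (toℕ t'))))

  adjHk : HkV l k m → HkV l k m → Bool
  adjHk x y = if removed x y then false else adj (vtx x) (vtx y)

  CrossEdge : HkV l k m → HkV l k m → Set
  CrossEdge x y = adjHk x y ≡ true × proj₁ (vtx x) ≢ proj₁ (vtx y)

  CrossPath : HkV l k m → HkV l k m → Set
  CrossPath x y = Σ[ zs ∈ List (HkV l k m) ]
    (Linked CrossEdge ((x ∷ zs) ∷ʳ y) × Unique ((x ∷ zs) ∷ʳ y))

countSubsets : (N : ℕ) → (Subset N → Bool) → ℕ
countSubsets zero P = if P [] then 1 else 0
countSubsets (suc N) P =
  countSubsets N (λ S → P (true ∷ S)) ℕ.+ countSubsets N (λ S → P (false ∷ S))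

allFin : (N : ℕ) → (Fin N → Bool) → Bool
allFin zero f = true
allFin (suc N) f = f Fin.zero ∧ allFin N (λ i → f (Fin.suc i))

module _ {n : ℕ} {l : Fin (suc n) → ℕ} {m : ℕ}
         (H : FullCover (ThetaV n l) ThetaEdge m) (k : Fin (suc n)) where

  -- vertices of H_k encoded as Fin (suc (l k) * m)
  NHk : ℕ
  NHk = suc (l k) ℕ.* m

  dec : Fin NHk → HkV l k m
  dec = remQuot m

  independent : Subset NHk → Bool
  independent S = allFin NHk (λ x → allFin NHk (λ y →
    not (lookup S x ∧ lookup S y ∧ adjHk H k (dec x) (dec y))))

  -- N({x , y}, H_k): number of H_k-colourings of G_k (independent sets of
  -- H_k of size |V(G_k)| = l k + 1) containing the vertices x and y
  N₂ : HkV l k m → HkV l k m → ℕ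
  N₂ (t , a) (t' , b) = countSubsets NHk (λ S →
    independent S ∧ (∣ S ∣ ≡ᵇ suc (l k)) ∧
    lookup S (combine t a) ∧ lookup S (combine t' b))

module Submission where

-- An H_k-colouring through (u , i) and (w , j) takes one vertex from each list along the path
-- u = v_0, …, v_L = w.  Inside a list H_k is a clique, between consecutive lists its edges are the
-- perfect matchings σ_t, and there are no other edges: the only further edges of Θ, between u and
-- w, are removed from H_k unless they belong to G_k.  So the colourings are the colour sequences
-- with c_0 = i, c_L = j and σ_t (c_t) ≠ c_(t+1).  Let D_L (a) count those starting at a.  Dropping
-- the first vertex gives D_(L+1) (a) = T_L − D′_L (σ_0 a), where D′ counts along the path from v_1
-- on and T_L = Σ_b D′_L (b) = (m − 1)^L, and induction gives
-- m D_L (a) = (m − 1)^L − (−1)^L + m [π_L a = j] (−1)^L with π_L = σ_(L−1) ∘ ⋯ ∘ σ_0.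
-- The cross-edges of H_k form m disjoint paths, and the one through (u , i) ends at (w , π_L i),
-- so a cross-edge path from (u , i) to (w , j) exists iff π_L i = j.

open import Defs
open import Data.Nat using (ℕ; suc; _≤_)
open import Data.Fin using (Fin; zero; fromℕ)
open import Data.Integer using (ℤ; +_; -_; _*_; _+_; _-_; _^_)
open import Data.Product using (_×_; _,_)
open import Relation.Binary.PropositionalEquality using (_≡_; _≢_)
open import Relation.Nullary using (¬_)

open import Data.Nat as ℕ using (zero; _<_; z≤n; s≤s; _∸_; _≡ᵇ_; _<?_)
import Data.Nat.Properties as ℕ
open import Data.Fin using (suc; toℕ; inject₁; _≟_; combine; remQuot)
import Data.Fin.Properties as Fin
import Data.Fin.Permutation as Perm
open import Data.Fin.Permutation using (Permutation′; _⟨$⟩ʳ_; permutation)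
open import Data.Fin.Subset using (Subset; ∣_∣; ⁅_⁆; ⊥; inside; outside; _∈_)
open import Data.Fin.Subset.Properties using (∣⁅x⁆∣≡1; x∈⁅y⁆⇒x≡y; x∈⁅x⁆; ∣⊥∣≡0; Empty-unique)
import Data.Integer.Properties as ℤ
open import Data.Integer.Tactic.RingSolver using (solve-∀)
open import Data.Vec using (Vec; []; _∷_; _++_; concat; lookup; tabulate; here; there)
open import Data.Vec.Properties using (lookup-concat; lookup∘tabulate; []=⇒lookup; lookup⇒[]=)
open import Data.Bool using (Bool; true; false; not; _∧_; _∨_; if_then_else_)
open import Data.Bool.Properties using (T-≡; ¬-not; ∧-comm; ∨-comm; ∨-zeroʳ; ⇔→≡)
open import Data.Maybe as Maybe using (Maybe; just; nothing; maybe′)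
open import Data.List as List using (List; []; _∷_; _∷ʳ_)
import Data.List.Properties as List
open import Data.List.Relation.Unary.All as All using (All; []; _∷_)
import Data.List.Relation.Unary.All.Properties as All
open import Data.List.Relation.Unary.AllPairs using ([]; _∷_)
open import Data.List.Relation.Unary.Linked as Linked using (Linked; [-]; _∷_)
import Data.List.Relation.Unary.Linked.Properties as Linked
open import Data.List.Relation.Unary.Unique.Propositional using (Unique)
import Data.List.Relation.Unary.Unique.Propositional.Properties as Unique
open import Data.Product using (Σ; Σ-syntax; proj₁; proj₂; map₁; uncurry)
open import Data.Sum using (_⊎_; inj₁; inj₂)
open import Data.Empty using (⊥-elim)
open import Function using (_∘_; Injection)
open import Function.Bundles using (_⇔_; mk⇔; Equivalence)
import Function.Properties.Equivalence as ⇔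
open import Function.Properties.Inverse using (Inverse⇒Injection)
open import Relation.Binary.PropositionalEquality
  using (refl; sym; trans; cong; cong₂; subst; subst₂; module ≡-Reasoning)
open import Relation.Nullary using (Dec; yes; no; does)
open import Relation.Nullary.Decidable using (dec-true; dec-false; decidable-stable)
open import Algebra.Properties.Semiring.Sum ℕ.+-*-semiring
  using (sum-syntax; sum-cong-≗; ∑-distrib-+; sum-permute)

open Equivalence using (to; from)

∧-true⁻ : ∀ {a b} → a ∧ b ≡ true → a ≡ true × b ≡ true
∧-true⁻ {true} b≡true = refl , b≡true

∧-true⁺ : ∀ {a b} → a ≡ true → b ≡ true → a ∧ b ≡ true
∧-true⁺ refl refl = refl

∨-true⁻ : ∀ {a b} → a ∨ b ≡ true → a ≡ true ⊎ b ≡ true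
∨-true⁻ {true} _ = inj₁ refl
∨-true⁻ {false} b≡true = inj₂ b≡true

∨-true⁺ : ∀ {a b} → a ≡ true ⊎ b ≡ true → a ∨ b ≡ true
∨-true⁺ (inj₁ refl) = refl
∨-true⁺ {a} (inj₂ refl) = ∨-zeroʳ a

not-∧-true⁻ : ∀ {p q r} → not (p ∧ q ∧ r) ≡ true → p ≡ true → q ≡ true → ¬ r ≡ true
not-∧-true⁻ () refl refl refl

not-∧-true⁺ : ∀ {p q r} → (p ≡ true → q ≡ true → ¬ r ≡ true) → not (p ∧ q ∧ r) ≡ true
not-∧-true⁺ {true} {true} {true} absurd = ⊥-elim (absurd refl refl refl)
not-∧-true⁺ {true} {true} {false} _ = refl
not-∧-true⁺ {true} {false} _ = refl
not-∧-true⁺ {false} _ = refl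

does-true⁻ : ∀ {A : Set} (d : Dec A) → does d ≡ true → A
does-true⁻ (yes a) _ = a

not-does-true⁻ : ∀ {A : Set} (d : Dec A) → not (does d) ≡ true → ¬ A
not-does-true⁻ (no ¬a) _ = ¬a

allFin-true⁻ : ∀ N {f : Fin N → Bool} → allFin N f ≡ true → ∀ x → f x ≡ true
allFin-true⁻ (suc N) holds zero = proj₁ (∧-true⁻ holds)
allFin-true⁻ (suc N) holds (suc x) = allFin-true⁻ N (proj₂ (∧-true⁻ holds)) x

allFin-true⁺ : ∀ N {f : Fin N → Bool} → (∀ x → f x ≡ true) → allFin N f ≡ true
allFin-true⁺ zero _ = refl
allFin-true⁺ (suc N) holds = ∧-true⁺ (holds zero) (allFin-true⁺ N (holds ∘ suc))

𝟙 : Bool → ℕ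
𝟙 b = if b then 1 else 0

∑-const : ∀ N x → ∑[ _ < N ] x ≡ N ℕ.* x
∑-const zero x = refl
∑-const (suc N) x = cong (x ℕ.+_) (∑-const N x)

∑-point : ∀ {N} (c : Fin N) (f : Fin N → ℕ) → ∑[ b < N ] (if does (c ≟ b) then f b else 0) ≡ f c
∑-point {suc N} zero f =
  trans (cong (f zero ℕ.+_) (trans (∑-const N 0) (ℕ.*-zeroʳ N))) (ℕ.+-identityʳ (f zero))
∑-point {suc N} (suc c) f = ∑-point c (f ∘ suc)

∑-remove : ∀ {N} (c : Fin N) (f : Fin N → ℕ) →
  ∑[ b < N ] (if not (does (c ≟ b)) then f b else 0) ℕ.+ f c ≡ ∑[ b < N ] f b
∑-remove {N} c f = begin
  ∑[ b < N ] others b ℕ.+ f c                   ≡⟨ cong (∑[ b < N ] others b ℕ.+_) (∑-point c f) ⟨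
  ∑[ b < N ] others b ℕ.+ ∑[ b < N ] only b      ≡⟨ ∑-distrib-+ others only ⟨
  ∑[ b < N ] (others b ℕ.+ only b)              ≡⟨ sum-cong-≗ (λ b → split (does (c ≟ b)) (f b)) ⟩
  ∑[ b < N ] f b                                ∎
  where
  open ≡-Reasoning
  others only : Fin N → ℕ
  others b = if not (does (c ≟ b)) then f b else 0
  only b = if does (c ≟ b) then f b else 0
  split : ∀ d x → (if not d then x else 0) ℕ.+ (if d then x else 0) ≡ x
  split true x = refl
  split false x = ℕ.+-identityʳ x

∑ₛ : (N : ℕ) → (Subset N → ℕ) → ℕ
∑ₛ zero f = f []
∑ₛ (suc N) f = ∑ₛ N (f ∘ (inside ∷_)) ℕ.+ ∑ₛ N (f ∘ (outside ∷_))

countSubsets≡∑ₛ𝟙 : ∀ N P → countSubsets N P ≡ ∑ₛ N (𝟙 ∘ P)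
countSubsets≡∑ₛ𝟙 zero P with P []
... | true = refl
... | false = refl
countSubsets≡∑ₛ𝟙 (suc N) P = cong₂ ℕ._+_ (countSubsets≡∑ₛ𝟙 N _) (countSubsets≡∑ₛ𝟙 N _)

∑ₛ-cong : ∀ N {f g : Subset N → ℕ} → (∀ S → f S ≡ g S) → ∑ₛ N f ≡ ∑ₛ N g
∑ₛ-cong zero f≗g = f≗g []
∑ₛ-cong (suc N) f≗g = cong₂ ℕ._+_ (∑ₛ-cong N (f≗g ∘ (inside ∷_))) (∑ₛ-cong N (f≗g ∘ (outside ∷_)))

∑ₛ-zero : ∀ N → ∑ₛ N (λ _ → 0) ≡ 0
∑ₛ-zero zero = refl
∑ₛ-zero (suc N) = cong₂ ℕ._+_ (∑ₛ-zero N) (∑ₛ-zero N)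

∑ₛ-++ : ∀ a b (f : Subset (a ℕ.+ b) → ℕ) → ∑ₛ (a ℕ.+ b) f ≡ ∑ₛ a (λ S → ∑ₛ b (λ S′ → f (S ++ S′)))
∑ₛ-++ zero b f = refl
∑ₛ-++ (suc a) b f = cong₂ ℕ._+_ (∑ₛ-++ a b _) (∑ₛ-++ a b _)

isEmpty : ∀ {N} → Subset N → Bool
isEmpty [] = true
isEmpty (x ∷ S) = not x ∧ isEmpty S

isEmpty⇒≡⊥ : ∀ {N} (S : Subset N) → isEmpty S ≡ true → S ≡ ⊥
isEmpty⇒≡⊥ [] _ = refl
isEmpty⇒≡⊥ (outside ∷ S) empty = cong (outside ∷_) (isEmpty⇒≡⊥ S empty)

isEmpty-⊥ : ∀ N → isEmpty (⊥ {N}) ≡ true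
isEmpty-⊥ zero = refl
isEmpty-⊥ (suc N) = isEmpty-⊥ N

element : ∀ {N} → Subset N → Maybe (Fin N)
element [] = nothing
element (inside ∷ S) = if isEmpty S then just zero else nothing
element (outside ∷ S) = Maybe.map suc (element S)

element⇒⁅⁆ : ∀ {N} (S : Subset N) {a} → element S ≡ just a → S ≡ ⁅ a ⁆
element⇒⁅⁆ (inside ∷ S) e with isEmpty S in empty
element⇒⁅⁆ (inside ∷ S) refl | true = cong (inside ∷_) (isEmpty⇒≡⊥ S empty)
element⇒⁅⁆ (outside ∷ S) e with element S in eS
element⇒⁅⁆ (outside ∷ S) refl | just a = cong (outside ∷_) (element⇒⁅⁆ S eS)

element-⁅⁆ : ∀ {N} (a : Fin N) → element ⁅ a ⁆ ≡ just a
element-⁅⁆ {suc N} zero rewrite isEmpty-⊥ N = refl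
element-⁅⁆ (suc a) rewrite element-⁅⁆ a = refl

∑ₛ-isEmpty : ∀ N x → ∑ₛ N (λ S → if isEmpty S then x else 0) ≡ x
∑ₛ-isEmpty zero x = refl
∑ₛ-isEmpty (suc N) x = cong₂ ℕ._+_ (∑ₛ-zero N) (∑ₛ-isEmpty N x)

∑ₛ-element : ∀ N (h : Fin N → ℕ) → ∑ₛ N (λ S → maybe′ h 0 (element S)) ≡ ∑[ a < N ] h a
∑ₛ-element zero h = refl
∑ₛ-element (suc N) h = cong₂ ℕ._+_
  (trans (∑ₛ-cong N (λ S → pick (isEmpty S))) (∑ₛ-isEmpty N (h zero)))
  (trans (∑ₛ-cong N (λ S → shift (element S))) (∑ₛ-element N (h ∘ suc)))
  where
  pick : ∀ b → maybe′ h 0 (if b then just zero else nothing) ≡ (if b then h zero else 0)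
  pick true = refl
  pick false = refl
  shift : ∀ x → maybe′ h 0 (Maybe.map suc x) ≡ maybe′ (h ∘ suc) 0 x
  shift (just _) = refl
  shift nothing = refl

∑ᵇ : ∀ {m} L → (Vec (Subset m) L → ℕ) → ℕ
∑ᵇ zero f = f []
∑ᵇ {m} (suc L) f = ∑ₛ m (λ S → ∑ᵇ L (f ∘ (S ∷_)))

∑ᵇ-cong : ∀ {m} L {f g : Vec (Subset m) L → ℕ} → (∀ Ss → f Ss ≡ g Ss) → ∑ᵇ L f ≡ ∑ᵇ L g
∑ᵇ-cong zero f≗g = f≗g []
∑ᵇ-cong {m} (suc L) f≗g = ∑ₛ-cong m (λ S → ∑ᵇ-cong L (f≗g ∘ (S ∷_)))

∑ᵇ-zero : ∀ {m} L → ∑ᵇ {m} L (λ _ → 0) ≡ 0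
∑ᵇ-zero zero = refl
∑ᵇ-zero {m} (suc L) = trans (∑ₛ-cong m (λ _ → ∑ᵇ-zero L)) (∑ₛ-zero m)

∑ₛ-concat : ∀ m L (f : Subset (L ℕ.* m) → ℕ) → ∑ₛ (L ℕ.* m) f ≡ ∑ᵇ L (f ∘ concat)
∑ₛ-concat m zero f = refl
∑ₛ-concat m (suc L) f = trans (∑ₛ-++ m (L ℕ.* m) f) (∑ₛ-cong m (λ S → ∑ₛ-concat m L (f ∘ (S ++_))))

Subsingleton : ∀ {N} → Subset N → Set
Subsingleton S = ∀ {a b} → a ∈ S → b ∈ S → a ≡ b

∣++∣ : ∀ {a b} (S : Subset a) (S′ : Subset b) → ∣ S ++ S′ ∣ ≡ ∣ S ∣ ℕ.+ ∣ S′ ∣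
∣++∣ [] S′ = refl
∣++∣ (inside ∷ S) S′ = cong suc (∣++∣ S S′)
∣++∣ (outside ∷ S) S′ = ∣++∣ S S′

∣S∣≡0⇒S≡⊥ : ∀ {N} (S : Subset N) → ∣ S ∣ ≡ 0 → S ≡ ⊥
∣S∣≡0⇒S≡⊥ [] _ = refl
∣S∣≡0⇒S≡⊥ (outside ∷ S) e = cong (outside ∷_) (∣S∣≡0⇒S≡⊥ S e)

∣S∣≡1⇒S≡⁅⁆ : ∀ {N} (S : Subset N) → ∣ S ∣ ≡ 1 → Σ[ a ∈ Fin N ] S ≡ ⁅ a ⁆
∣S∣≡1⇒S≡⁅⁆ (inside ∷ S) e = zero , cong (inside ∷_) (∣S∣≡0⇒S≡⊥ S (ℕ.suc-injective e))
∣S∣≡1⇒S≡⁅⁆ (outside ∷ S) e with ∣S∣≡1⇒S≡⁅⁆ S e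
... | a , refl = suc a , refl

Subsingleton⇒∣S∣≤1 : ∀ {N} (S : Subset N) → Subsingleton S → ∣ S ∣ ≤ 1
Subsingleton⇒∣S∣≤1 [] _ = z≤n
Subsingleton⇒∣S∣≤1 (outside ∷ S) sub =
  Subsingleton⇒∣S∣≤1 S (λ a∈ b∈ → Fin.suc-injective (sub (there a∈) (there b∈)))
Subsingleton⇒∣S∣≤1 {suc N} (inside ∷ S) sub =
  s≤s (ℕ.≤-reflexive (trans (cong ∣_∣ (Empty-unique empty)) (∣⊥∣≡0 N)))
  where
  empty : ¬ Σ (Fin N) (_∈ S)
  empty (a , a∈S) with sub here (there a∈S)
  ... | ()

∣concat∣≤ : ∀ {m L} (Ss : Vec (Subset m) L) → (∀ t → Subsingleton (lookup Ss t)) → ∣ concat Ss ∣ ≤ L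
∣concat∣≤ [] _ = z≤n
∣concat∣≤ (S ∷ Ss) sub = ℕ.≤-trans (ℕ.≤-reflexive (∣++∣ S (concat Ss)))
  (ℕ.+-mono-≤ (Subsingleton⇒∣S∣≤1 S (sub zero)) (∣concat∣≤ Ss (sub ∘ suc)))

m≤1∧n≤k∧m+n≡1+k⇒m≡1∧n≡k : ∀ {m n k} → m ≤ 1 → n ≤ k → m ℕ.+ n ≡ suc k → m ≡ 1 × n ≡ k
m≤1∧n≤k∧m+n≡1+k⇒m≡1∧n≡k {zero} _ n≤k refl = ⊥-elim (ℕ.<-irrefl refl n≤k)
m≤1∧n≤k∧m+n≡1+k⇒m≡1∧n≡k {suc zero} _ _ e = refl , ℕ.suc-injective e
m≤1∧n≤k∧m+n≡1+k⇒m≡1∧n≡k {suc (suc _)} (s≤s ()) _ _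

∣concat∣≡⇒singletons : ∀ {m L} (Ss : Vec (Subset m) L) → (∀ t → Subsingleton (lookup Ss t)) →
  ∣ concat Ss ∣ ≡ L → Σ[ c ∈ (Fin L → Fin m) ] Ss ≡ tabulate (⁅_⁆ ∘ c)
∣concat∣≡⇒singletons [] _ _ = (λ ()) , refl
∣concat∣≡⇒singletons (S ∷ Ss) sub size
  with m≤1∧n≤k∧m+n≡1+k⇒m≡1∧n≡k (Subsingleton⇒∣S∣≤1 S (sub zero)) (∣concat∣≤ Ss (sub ∘ suc))
         (trans (sym (∣++∣ S (concat Ss))) size)
... | ∣S∣≡1 , ∣Ss∣≡L with ∣S∣≡1⇒S≡⁅⁆ S ∣S∣≡1 | ∣concat∣≡⇒singletons Ss (sub ∘ suc) ∣Ss∣≡L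
... | a , refl | c , refl = (λ { zero → a ; (suc t) → c t }) , refl

∣concat-⁅⁆∣ : ∀ {m L} (c : Fin L → Fin m) → ∣ concat (tabulate (⁅_⁆ ∘ c)) ∣ ≡ L
∣concat-⁅⁆∣ {L = zero} c = refl
∣concat-⁅⁆∣ {L = suc L} c =
  trans (∣++∣ ⁅ c zero ⁆ _) (cong₂ ℕ._+_ (∣⁅x⁆∣≡1 (c zero)) (∣concat-⁅⁆∣ (c ∘ suc)))

∈-⁅⁆-blocks : ∀ {m N} (c : Fin N → Fin m) t {a} → a ∈ lookup (tabulate (⁅_⁆ ∘ c)) t ⇔ a ≡ c t
∈-⁅⁆-blocks c t {a} = mk⇔
  (λ a∈ → x∈⁅y⁆⇒x≡y (c t) (subst (a ∈_) (lookup∘tabulate (⁅_⁆ ∘ c) t) a∈))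
  (λ { refl → subst (c t ∈_) (sym (lookup∘tabulate (⁅_⁆ ∘ c) t)) (x∈⁅x⁆ (c t)) })

module _ {m : ℕ} where

  -- the full m-fold cover of the path 0 − 1 − ⋯ − L in which levels t and t + 1 are matched by σ t
  data Cross (σ : ℕ → Permutation′ m) {L : ℕ} : Fin (suc L) × Fin m → Fin (suc L) × Fin m → Set where
    forward  : ∀ (s : Fin L) {a b} → σ (toℕ s) ⟨$⟩ʳ a ≡ b → Cross σ (inject₁ s , a) (suc s , b)
    backward : ∀ (s : Fin L) {a b} → σ (toℕ s) ⟨$⟩ʳ a ≡ b → Cross σ (suc s , b) (inject₁ s , a)

  data Adjacent (σ : ℕ → Permutation′ m) {L : ℕ} : Fin (suc L) × Fin m → Fin (suc L) × Fin m → Set where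
    within : ∀ {t a b} → a ≢ b → Adjacent σ (t , a) (t , b)
    cross  : ∀ {x y} → Cross σ x y → Adjacent σ x y

  transport : ℕ → (ℕ → Permutation′ m) → Fin m → Fin m
  transport zero σ a = a
  transport (suc t) σ a = transport t (σ ∘ suc) (σ 0 ⟨$⟩ʳ a)

  transport-suc : ∀ t σ a → transport (suc t) σ a ≡ σ t ⟨$⟩ʳ transport t σ a
  transport-suc zero σ a = refl
  transport-suc (suc t) σ a = transport-suc t (σ ∘ suc) (σ 0 ⟨$⟩ʳ a)

  Proper : ∀ {L} → (ℕ → Permutation′ m) → (Fin (suc L) → Fin m) → Set
  Proper {L} σ c = ∀ (s : Fin L) → σ (toℕ s) ⟨$⟩ʳ c (inject₁ s) ≢ c (suc s)

  Cross⇒levels≢ : ∀ {σ L} {x y : Fin (suc L) × Fin m} → Cross σ x y → toℕ (proj₁ x) ≢ toℕ (proj₁ y)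
  Cross⇒levels≢ (forward s _) e = ℕ.1+n≢n (sym (trans (sym (Fin.toℕ-inject₁ s)) e))
  Cross⇒levels≢ (backward s _) e = ℕ.1+n≢n (trans e (Fin.toℕ-inject₁ s))

  Proper⇒¬Adjacent : ∀ {σ L} {c : Fin (suc L) → Fin m} → Proper σ c →
    ∀ {t t′} → ¬ Adjacent σ (t , c t) (t′ , c t′)
  Proper⇒¬Adjacent proper (within c≢c) = c≢c refl
  Proper⇒¬Adjacent proper (cross (forward s e)) = proper s e
  Proper⇒¬Adjacent proper (cross (backward s e)) = proper s e

data Relative {L : ℕ} : Fin (suc L) → Fin (suc L) → Set where
  same  : ∀ {t} → Relative t t
  next  : ∀ (s : Fin L) → Relative (inject₁ s) (suc s)
  prev  : ∀ (s : Fin L) → Relative (suc s) (inject₁ s)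
  apart : ∀ {t t′} → toℕ t ≢ toℕ t′ → toℕ t′ ≢ suc (toℕ t) → toℕ t ≢ suc (toℕ t′) → Relative t t′

successor : ∀ {L} {t t′ : Fin (suc L)} → toℕ t′ ≡ suc (toℕ t) → Σ[ s ∈ Fin L ] t ≡ inject₁ s × t′ ≡ suc s
successor {t′ = suc s} e =
  s , Fin.toℕ-injective (trans (ℕ.suc-injective (sym e)) (sym (Fin.toℕ-inject₁ s))) , refl

relative : ∀ {L} (t t′ : Fin (suc L)) → Relative t t′
relative t t′ with toℕ t ℕ.≟ toℕ t′ | toℕ t′ ℕ.≟ suc (toℕ t) | toℕ t ℕ.≟ suc (toℕ t′)
... | yes e | _ | _ rewrite Fin.toℕ-injective e = same
... | no _ | yes e | _ with successor e
...   | s , refl , refl = next s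
relative t t′ | no _ | no _ | yes e with successor e
...   | s , refl , refl = prev s
relative t t′ | no ne | no ne₁ | no ne₂ = apart ne ne₁ ne₂

module Colourings {m : ℕ} (j : Fin m) where

  record Colouring (L : ℕ) (σ : ℕ → Permutation′ m) (first : Fin m → Bool)
                   (Ss : Vec (Subset m) (suc L)) : Set where
    field
      colour : Fin (suc L) → Fin m
      blocks : Ss ≡ tabulate (⁅_⁆ ∘ colour)
      starts : first (colour zero) ≡ true
      ends   : colour (fromℕ L) ≡ j
      proper : Proper σ colour

  -- a decision procedure for Colouring that recurses along the path, so that it can be counted
  colouring? : (L : ℕ) → (ℕ → Permutation′ m) → (Fin m → Bool) → Vec (Subset m) (suc L) → Bool
  colouringFrom? : (L : ℕ) → (ℕ → Permutation′ m) → Fin m → Vec (Subset m) L → Bool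

  colouring? L σ first (S ∷ Ss) = maybe′ (λ a → first a ∧ colouringFrom? L σ a Ss) false (element S)

  colouringFrom? zero σ a [] = does (j ≟ a)
  colouringFrom? (suc L) σ a Ss = colouring? L (σ ∘ suc) (λ b → not (does (σ 0 ⟨$⟩ʳ a ≟ b))) Ss

  colouring?-∷⁻ : ∀ L σ first S Ss → colouring? L σ first (S ∷ Ss) ≡ true →
    Σ[ a ∈ Fin m ] S ≡ ⁅ a ⁆ × first a ≡ true × colouringFrom? L σ a Ss ≡ true
  colouring?-∷⁻ L σ first S Ss holds with element S in elem
  ... | just a = a , element⇒⁅⁆ S elem , ∧-true⁻ holds

  colouring?-sound : ∀ L σ first Ss → colouring? L σ first Ss ≡ true → Colouring L σ first Ss
  colouring?-sound zero σ first (S ∷ []) holds with colouring?-∷⁻ zero σ first S [] holds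
  ... | a , refl , first-a , j≟a = record
    { colour = λ _ → a
    ; blocks = refl
    ; starts = first-a
    ; ends   = sym (does-true⁻ (j ≟ a) j≟a)
    ; proper = λ ()
    }
  colouring?-sound (suc L) σ first (S ∷ Ss) holds with colouring?-∷⁻ (suc L) σ first S Ss holds
  ... | a , refl , first-a , rest = record
    { colour = λ { zero → a ; (suc t) → colour t }
    ; blocks = cong (⁅ a ⁆ ∷_) blocks
    ; starts = first-a
    ; ends   = ends
    ; proper = λ { zero → not-does-true⁻ (σ 0 ⟨$⟩ʳ a ≟ colour zero) starts ; (suc s) → proper s }
    }
    where open Colouring (colouring?-sound L (σ ∘ suc) (λ b → not (does (σ 0 ⟨$⟩ʳ a ≟ b))) Ss rest)

  colouring?-complete : ∀ L σ first Ss → Colouring L σ first Ss → colouring? L σ first Ss ≡ true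
  colouring?-complete L σ first _
    record { colour = c ; blocks = refl ; starts = starts ; ends = ends ; proper = proper }
    rewrite element-⁅⁆ (c zero) = ∧-true⁺ starts (colouringFrom?-complete L σ c ends proper)
    where
    colouringFrom?-complete : ∀ L σ (c : Fin (suc L) → Fin m) → c (fromℕ L) ≡ j → Proper σ c →
      colouringFrom? L σ (c zero) (tabulate (⁅_⁆ ∘ c ∘ suc)) ≡ true
    colouringFrom?-complete zero σ c ends _ = dec-true (j ≟ c zero) (sym ends)
    colouringFrom?-complete (suc L) σ c ends proper = colouring?-complete L (σ ∘ suc) _ _ record
      { colour = c ∘ suc
      ; blocks = refl
      ; starts = cong not (dec-false (σ 0 ⟨$⟩ʳ c zero ≟ c (suc zero)) (proper zero))
      ; ends   = ends
      ; proper = proper ∘ suc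
      }

  colouring?⇔ : ∀ L σ first Ss → colouring? L σ first Ss ≡ true ⇔ Colouring L σ first Ss
  colouring?⇔ L σ first Ss = mk⇔ (colouring?-sound L σ first Ss) (colouring?-complete L σ first Ss)

  #colourings : (L : ℕ) → (ℕ → Permutation′ m) → Fin m → ℕ
  #colourings L σ a = ∑ᵇ L (𝟙 ∘ colouringFrom? L σ a)

  ∑ᵇ-colouring? : ∀ L σ first →
    ∑ᵇ (suc L) (𝟙 ∘ colouring? L σ first) ≡ ∑[ a < m ] (if first a then #colourings L σ a else 0)
  ∑ᵇ-colouring? L σ first = trans (∑ₛ-cong m (λ S → ∑ᵇ-tail (element S))) (∑ₛ-element m _)
    where
    ∑ᵇ-tail : ∀ x → ∑ᵇ L (λ Ss → 𝟙 (maybe′ (λ a → first a ∧ colouringFrom? L σ a Ss) false x))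
                  ≡ maybe′ (λ a → if first a then #colourings L σ a else 0) 0 x
    ∑ᵇ-tail nothing = ∑ᵇ-zero L
    ∑ᵇ-tail (just a) with first a
    ... | true = refl
    ... | false = ∑ᵇ-zero L

  #colourings-suc : ∀ L σ a → #colourings (suc L) σ a ℕ.+ #colourings L (σ ∘ suc) (σ 0 ⟨$⟩ʳ a)
                              ≡ ∑[ b < m ] #colourings L (σ ∘ suc) b
  #colourings-suc L σ a =
    trans (cong (ℕ._+ #colourings L (σ ∘ suc) (σ 0 ⟨$⟩ʳ a)) (∑ᵇ-colouring? L (σ ∘ suc) _))
          (∑-remove (σ 0 ⟨$⟩ʳ a) (#colourings L (σ ∘ suc)))

  ∑#colourings-suc : ∀ L σ → ∑[ a < m ] #colourings (suc L) σ a ℕ.+ ∑[ b < m ] #colourings L (σ ∘ suc) b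
                             ≡ m ℕ.* ∑[ b < m ] #colourings L (σ ∘ suc) b
  ∑#colourings-suc L σ = begin
    ∑[ a < m ] D₁ a ℕ.+ ∑[ b < m ] D b                ≡⟨ cong (∑[ a < m ] D₁ a ℕ.+_) (sum-permute D (σ 0)) ⟩
    ∑[ a < m ] D₁ a ℕ.+ ∑[ a < m ] D (σ 0 ⟨$⟩ʳ a)     ≡⟨ ∑-distrib-+ D₁ (D ∘ (σ 0 ⟨$⟩ʳ_)) ⟨
    ∑[ a < m ] (D₁ a ℕ.+ D (σ 0 ⟨$⟩ʳ a))             ≡⟨ sum-cong-≗ (#colourings-suc L σ) ⟩
    ∑[ a < m ] (∑[ b < m ] D b)                      ≡⟨ ∑-const m _ ⟩
    m ℕ.* ∑[ b < m ] D b                             ∎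
    where
    open ≡-Reasoning
    D₁ D : Fin m → ℕ
    D₁ = #colourings (suc L) σ
    D = #colourings L (σ ∘ suc)

  private
    x+y≡z⇒x≡z-y : ∀ {x y z : ℤ} → x + y ≡ z → x ≡ z - y
    x+y≡z⇒x≡z-y {x} {y} refl = x≡x+y-y x y
      where
      x≡x+y-y : ∀ x y → x ≡ x + y - y
      x≡x+y-y = solve-∀

  +∑#colourings : ∀ L σ → + (∑[ a < m ] #colourings L σ a) ≡ (+ m - + 1) ^ L
  +∑#colourings zero σ = cong +_ (∑-point j (λ _ → 1))
  +∑#colourings (suc L) σ = begin
    + T₁                 ≡⟨ T₁≡mT-T ⟩
    + m * + T - + T      ≡⟨ m*x-x≡[m-1]*x (+ m) (+ T) ⟩
    (+ m - + 1) * + T    ≡⟨ cong ((+ m - + 1) *_) (+∑#colourings L (σ ∘ suc)) ⟩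
    (+ m - + 1) ^ suc L  ∎
    where
    open ≡-Reasoning
    T₁ T : ℕ
    T₁ = ∑[ a < m ] #colourings (suc L) σ a
    T = ∑[ b < m ] #colourings L (σ ∘ suc) b
    T₁≡mT-T : + T₁ ≡ + m * + T - + T
    T₁≡mT-T = x+y≡z⇒x≡z-y (trans (sym (ℤ.pos-+ T₁ T)) (trans (cong +_ (∑#colourings-suc L σ)) (ℤ.pos-* m T)))
    m*x-x≡[m-1]*x : ∀ M x → M * x - x ≡ (M - + 1) * x
    m*x-x≡[m-1]*x = solve-∀

  closedForm : ℕ → ℤ → ℤ
  closedForm L δ = (+ m - + 1) ^ L - (- + 1) ^ L + + m * δ * (- + 1) ^ L

  #colourings-closed : ∀ L σ a → + m * + #colourings L σ a ≡ closedForm L (+ 𝟙 (does (j ≟ transport L σ a)))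
  #colourings-closed zero σ a = base (+ m) (+ 𝟙 (does (j ≟ a)))
    where
    base : ∀ M δ → M * δ ≡ + 1 - + 1 + M * δ * + 1
    base = solve-∀
  #colourings-closed (suc L) σ a = begin
    + m * + D₁                       ≡⟨ cong (+ m *_) D₁≡T-D ⟩
    + m * (+ T - + D)                ≡⟨ distrib (+ m) (+ T) (+ D) ⟩
    + m * + T - + m * + D            ≡⟨ cong₂ (λ t d → + m * t - d) (+∑#colourings L σ′) closed-b ⟩
    + m * A - (A - B + + m * δ * B)  ≡⟨ step (+ m) A B δ ⟩
    closedForm (suc L) δ             ∎
    where
    open ≡-Reasoning
    σ′ : ℕ → Permutation′ m
    σ′ = σ ∘ suc
    b : Fin m
    b = σ 0 ⟨$⟩ʳ a
    D₁ D T : ℕ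
    D₁ = #colourings (suc L) σ a
    D = #colourings L σ′ b
    T = ∑[ c < m ] #colourings L σ′ c
    A B δ : ℤ
    A = (+ m - + 1) ^ L
    B = (- + 1) ^ L
    δ = + 𝟙 (does (j ≟ transport (suc L) σ a))
    closed-b : + m * + D ≡ closedForm L δ
    closed-b = #colourings-closed L σ′ b
    D₁≡T-D : + D₁ ≡ + T - + D
    D₁≡T-D = x+y≡z⇒x≡z-y {y = + D} (trans (sym (ℤ.pos-+ D₁ D)) (cong +_ (#colourings-suc L σ a)))
    distrib : ∀ M x y → M * (x - y) ≡ M * x - M * y
    distrib = solve-∀
    step : ∀ M A B δ → M * A - (A - B + M * δ * B) ≡ (M - + 1) * A - - + 1 * B + M * δ * (- + 1 * B)
    step = solve-∀

  #colourings-aligned : ∀ L σ a → transport L σ a ≡ j →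
    + m * + #colourings L σ a ≡ (+ m - + 1) ^ L + (- + 1) ^ L * (+ m - + 1)
  #colourings-aligned L σ a aligned = begin
    + m * + #colourings L σ a                        ≡⟨ #colourings-closed L σ a ⟩
    closedForm L (+ 𝟙 (does (j ≟ transport L σ a)))  ≡⟨ cong (closedForm L ∘ +_ ∘ 𝟙) (dec-true (j ≟ _) (sym aligned)) ⟩
    closedForm L (+ 1)                               ≡⟨ simplify (+ m) ((+ m - + 1) ^ L) ((- + 1) ^ L) ⟩
    (+ m - + 1) ^ L + (- + 1) ^ L * (+ m - + 1)      ∎
    where
    open ≡-Reasoning
    simplify : ∀ M A B → A - B + M * + 1 * B ≡ A + B * (M - + 1)
    simplify = solve-∀

  #colourings-misaligned : ∀ L σ a → transport L σ a ≢ j →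
    + m * + #colourings L σ a ≡ (+ m - + 1) ^ L - (- + 1) ^ L
  #colourings-misaligned L σ a misaligned = begin
    + m * + #colourings L σ a                        ≡⟨ #colourings-closed L σ a ⟩
    closedForm L (+ 𝟙 (does (j ≟ transport L σ a)))  ≡⟨ cong (closedForm L ∘ +_ ∘ 𝟙) (dec-false (j ≟ _) (misaligned ∘ sym)) ⟩
    closedForm L (+ 0)                               ≡⟨ simplify (+ m) ((+ m - + 1) ^ L) ((- + 1) ^ L) ⟩
    (+ m - + 1) ^ L - (- + 1) ^ L                    ∎
    where
    open ≡-Reasoning
    simplify : ∀ M A B → A - B + M * + 0 * B ≡ A - B
    simplify = solve-∀

module Independence {m L : ℕ} (σ : ℕ → Permutation′ m)
                    (adj : Fin (suc L) × Fin m → Fin (suc L) × Fin m → Bool)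
                    (adj⇔ : ∀ x y → adj x y ≡ true ⇔ Adjacent σ x y) where

  -- with adj = adjHk H k, independent? and #colouringsThrough are definitionally Defs' independent and N₂
  independent? : Subset (suc L ℕ.* m) → Bool
  independent? S = allFin (suc L ℕ.* m) (λ x → allFin (suc L ℕ.* m) (λ y →
    not (lookup S x ∧ lookup S y ∧ adj (remQuot m x) (remQuot m y))))

  colouringThrough? : Fin (suc L) × Fin m → Fin (suc L) × Fin m → Subset (suc L ℕ.* m) → Bool
  colouringThrough? x y S =
    independent? S ∧ (∣ S ∣ ≡ᵇ suc L) ∧ lookup S (uncurry combine x) ∧ lookup S (uncurry combine y)

  #colouringsThrough : Fin (suc L) × Fin m → Fin (suc L) × Fin m → ℕ
  #colouringsThrough x y = countSubsets (suc L ℕ.* m) (colouringThrough? x y)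

  Independent : Vec (Subset m) (suc L) → Set
  Independent Ss = ∀ {t a t′ b} → a ∈ lookup Ss t → b ∈ lookup Ss t′ → ¬ Adjacent σ (t , a) (t′ , b)

  ∈-concat⇔ : ∀ (Ss : Vec (Subset m) (suc L)) t a → lookup (concat Ss) (combine t a) ≡ true ⇔ a ∈ lookup Ss t
  ∈-concat⇔ Ss t a = mk⇔
    (λ a∈ → lookup⇒[]= a (lookup Ss t) (trans (sym (lookup-concat Ss t a)) a∈))
    (λ a∈ → trans (lookup-concat Ss t a) ([]=⇒lookup a∈))

  independent?-sound : ∀ Ss → independent? (concat Ss) ≡ true → Independent Ss
  independent?-sound Ss holds {t} {a} {t′} {b} a∈ b∈ adjacent =
    not-∧-true⁻ (allFin-true⁻ _ (allFin-true⁻ _ holds (combine t a)) (combine t′ b))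
      (from (∈-concat⇔ Ss t a) a∈) (from (∈-concat⇔ Ss t′ b) b∈)
      (subst₂ (λ x y → adj x y ≡ true) (sym (Fin.remQuot-combine t a)) (sym (Fin.remQuot-combine t′ b))
        (from (adj⇔ _ _) adjacent))

  independent?-complete : ∀ Ss → Independent Ss → independent? (concat Ss) ≡ true
  independent?-complete Ss independent = allFin-true⁺ _ λ x → allFin-true⁺ _ λ y →
    not-∧-true⁺ λ x∈ y∈ adjacent → independent (member x x∈) (member y y∈) (to (adj⇔ _ _) adjacent)
    where
    member : ∀ x → lookup (concat Ss) x ≡ true → proj₂ (remQuot m x) ∈ lookup Ss (proj₁ (remQuot m x))
    member x x∈ = to (∈-concat⇔ Ss _ _) (trans (cong (lookup (concat Ss)) (Fin.combine-remQuot {suc L} m x)) x∈)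

  independent?⇒Subsingleton : ∀ Ss → independent? (concat Ss) ≡ true → ∀ t → Subsingleton (lookup Ss t)
  independent?⇒Subsingleton Ss independent t a∈ b∈ =
    decidable-stable (_ ≟ _) λ a≢b → independent?-sound Ss independent a∈ b∈ (within a≢b)

  module _ (i j : Fin m) where
    open Colourings j

    through? : Subset (suc L ℕ.* m) → Bool
    through? = colouringThrough? (zero , i) (fromℕ L , j)

    through?-sound : ∀ Ss → through? (concat Ss) ≡ true → Colouring L σ (does ∘ (i ≟_)) Ss
    through?-sound Ss holds with ∧-true⁻ {independent? (concat Ss)} holds
    ... | independent , rest with ∧-true⁻ {∣ concat Ss ∣ ≡ᵇ suc L} rest
    ... | size , ends with ∧-true⁻ {lookup (concat Ss) (combine {suc L} zero i)} ends
    ... | i∈ , j∈ with ∣concat∣≡⇒singletons Ss (independent?⇒Subsingleton Ss independent)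
                         (ℕ.≡ᵇ⇒≡ _ _ (from T-≡ size))
    ... | c , refl = record
      { colour = c
      ; blocks = refl
      ; starts = dec-true (i ≟ c zero) (sym (member zero i∈))
      ; ends   = member (fromℕ L) j∈
      ; proper = λ s e → independent?-sound Ss independent
          (from (∈-⁅⁆-blocks c (inject₁ s)) refl)
          (from (∈-⁅⁆-blocks c (suc s)) refl)
          (cross (forward s e))
      }
      where
      member : ∀ t {a} → lookup (concat Ss) (combine t a) ≡ true → c t ≡ a
      member t a∈ = sym (to (∈-⁅⁆-blocks c t) (to (∈-concat⇔ Ss t _) a∈))

    through?-complete : ∀ Ss → Colouring L σ (does ∘ (i ≟_)) Ss → through? (concat Ss) ≡ true
    through?-complete Ss record { colour = c ; blocks = refl ; starts = starts ; ends = ends ; proper = proper } =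
      ∧-true⁺ (independent?-complete Ss nonadjacent)
        (∧-true⁺ (to T-≡ (ℕ.≡⇒≡ᵇ _ _ (∣concat-⁅⁆∣ c)))
          (∧-true⁺ (member zero (does-true⁻ (i ≟ c zero) starts)) (member (fromℕ L) (sym ends))))
      where
      member : ∀ t {a} → a ≡ c t → lookup (concat Ss) (combine t a) ≡ true
      member t a≡ = from (∈-concat⇔ Ss t _) (from (∈-⁅⁆-blocks c t) a≡)
      nonadjacent : Independent Ss
      nonadjacent {t} {_} {t′} a∈ b∈ with to (∈-⁅⁆-blocks c t) a∈ | to (∈-⁅⁆-blocks c t′) b∈
      ... | refl | refl = Proper⇒¬Adjacent proper

    #colouringsThrough≡#colourings : #colouringsThrough (zero , i) (fromℕ L , j) ≡ #colourings L σ i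
    #colouringsThrough≡#colourings = begin
      countSubsets (suc L ℕ.* m) through?                          ≡⟨ countSubsets≡∑ₛ𝟙 _ through? ⟩
      ∑ₛ (suc L ℕ.* m) (𝟙 ∘ through?)                              ≡⟨ ∑ₛ-concat m (suc L) (𝟙 ∘ through?) ⟩
      ∑ᵇ (suc L) (𝟙 ∘ through? ∘ concat)                           ≡⟨ ∑ᵇ-cong (suc L) (cong 𝟙 ∘ through≡colouring?) ⟩
      ∑ᵇ (suc L) (𝟙 ∘ colouring? L σ (does ∘ (i ≟_)))              ≡⟨ ∑ᵇ-colouring? L σ (does ∘ (i ≟_)) ⟩
      ∑[ a < m ] (if does (i ≟ a) then #colourings L σ a else 0)  ≡⟨ ∑-point i (#colourings L σ) ⟩
      #colourings L σ i                                            ∎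
      where
      open ≡-Reasoning
      through≡colouring? : ∀ Ss → through? (concat Ss) ≡ colouring? L σ (does ∘ (i ≟_)) Ss
      through≡colouring? Ss = ⇔→≡ (⇔.trans (mk⇔ (through?-sound Ss) (through?-complete Ss))
                                            (⇔.sym (colouring?⇔ L σ _ Ss)))

SimplePath : ∀ {V : Set} → (V → V → Set) → V → V → Set
SimplePath {V} R x y = Σ[ zs ∈ List V ] Linked R ((x ∷ zs) ∷ʳ y) × Unique ((x ∷ zs) ∷ʳ y)

SimplePath-map : ∀ {V : Set} {R R′ : V → V → Set} → (∀ {x y} → R x y → R′ x y) →
  ∀ {x y} → SimplePath R x y → SimplePath R′ x y
SimplePath-map f (zs , linked , unique) = zs , Linked.map f linked , unique

Linked-preserves : ∀ {V : Set} {R : V → V → Set} (P : V → Set) → (∀ {x y} → R x y → P x → P y) →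
  ∀ {x xs} → Linked R (x ∷ xs) → P x → All P (x ∷ xs)
Linked-preserves P step [-] px = px ∷ []
Linked-preserves P step (r ∷ rs) px = px ∷ Linked-preserves P step rs (step r px)

SimplePath-preserves : ∀ {V : Set} {R : V → V → Set} (P : V → Set) → (∀ {x y} → R x y → P x → P y) →
  ∀ {x y} → SimplePath R x y → P x → P y
SimplePath-preserves P step (zs , linked , _) px =
  proj₂ (All.∷ʳ⁻ {xs = _ ∷ zs} (Linked-preserves P step linked px))

module _ {m : ℕ} (σ : ℕ → Permutation′ m) (i : Fin m) where

  -- the vertices of the component of (0 , i) in the graph of cross-edges
  Canonical : ∀ {L} → Fin (suc L) × Fin m → Set
  Canonical (t , b) = transport (toℕ t) σ i ≡ b

  Cross-preserves-Canonical : ∀ {L} {x y : Fin (suc L) × Fin m} → Cross σ x y → Canonical x → Canonical y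
  Cross-preserves-Canonical (forward s {a} {b} σa≡b) canonical = begin
    transport (suc (toℕ s)) σ i                      ≡⟨ transport-suc (toℕ s) σ i ⟩
    σ (toℕ s) ⟨$⟩ʳ transport (toℕ s) σ i              ≡⟨ cong (λ t → σ (toℕ s) ⟨$⟩ʳ transport t σ i) s≡s ⟨
    σ (toℕ s) ⟨$⟩ʳ transport (toℕ (inject₁ s)) σ i    ≡⟨ cong (σ (toℕ s) ⟨$⟩ʳ_) canonical ⟩
    σ (toℕ s) ⟨$⟩ʳ a                                 ≡⟨ σa≡b ⟩
    b                                                ∎
    where
    open ≡-Reasoning
    s≡s : toℕ (inject₁ s) ≡ toℕ s
    s≡s = Fin.toℕ-inject₁ s
  Cross-preserves-Canonical (backward s σa≡b) canonical =
    trans (cong (λ t → transport t σ i) (Fin.toℕ-inject₁ s))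
      (Injection.injective (Inverse⇒Injection (σ (toℕ s)))
        (trans (sym (transport-suc (toℕ s) σ i)) (trans canonical (sym σa≡b))))

  SimplePath⇒transport : ∀ {L j} → SimplePath (Cross σ) (zero , i) (fromℕ L , j) → transport L σ i ≡ j
  SimplePath⇒transport {L} path =
    trans (cong (λ t → transport t σ i) (sym (Fin.toℕ-fromℕ L)))
      (SimplePath-preserves Canonical Cross-preserves-Canonical path refl)

module _ {m : ℕ} where

  walk : ∀ L → (ℕ → Permutation′ m) → Fin m → List (Fin (suc L) × Fin m)
  walkTail : ∀ L → (ℕ → Permutation′ m) → Fin m → List (Fin (suc L) × Fin m)
  walk L σ a = (zero , a) ∷ walkTail L σ a
  walkTail zero σ a = []
  walkTail (suc L) σ a = List.map (map₁ suc) (walk L (σ ∘ suc) (σ 0 ⟨$⟩ʳ a))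

  Cross-suc : ∀ {L} {σ : ℕ → Permutation′ m} {x y : Fin (suc L) × Fin m} →
    Cross (σ ∘ suc) x y → Cross σ (map₁ suc x) (map₁ suc y)
  Cross-suc (forward s e) = forward (suc s) e
  Cross-suc (backward s e) = backward (suc s) e

  walk-linked : ∀ L σ a → Linked (Cross σ) (walk L σ a)
  walk-linked zero σ a = [-]
  walk-linked (suc L) σ a =
    forward zero refl ∷ Linked.map⁺ (Linked.map Cross-suc (walk-linked L (σ ∘ suc) (σ 0 ⟨$⟩ʳ a)))

  walk-unique : ∀ L σ a → Unique (walk L σ a)
  walk-unique zero σ a = [] ∷ []
  walk-unique (suc L) σ a =
    All.map⁺ (All.universal (λ _ ()) (walk L (σ ∘ suc) (σ 0 ⟨$⟩ʳ a)))
    ∷ Unique.map⁺ (λ e → cong₂ _,_ (Fin.suc-injective (cong proj₁ e)) (cong proj₂ e))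
                  (walk-unique L (σ ∘ suc) (σ 0 ⟨$⟩ʳ a))

  walkTail-last : ∀ L σ a → Σ[ zs ∈ List (Fin (suc (suc L)) × Fin m) ]
    walkTail (suc L) σ a ≡ zs ∷ʳ (fromℕ (suc L) , transport (suc L) σ a)
  walkTail-last zero σ a = [] , refl
  walkTail-last (suc L) σ a with walkTail-last L (σ ∘ suc) (σ 0 ⟨$⟩ʳ a)
  ... | zs , e = List.map (map₁ suc) ((zero , σ 0 ⟨$⟩ʳ a) ∷ zs) ,
    trans (cong (List.map (map₁ suc) ∘ ((zero , σ 0 ⟨$⟩ʳ a) ∷_)) e)
          (List.map-++ (map₁ suc) ((zero , σ 0 ⟨$⟩ʳ a) ∷ zs) _)

  transport⇒SimplePath : ∀ {L} (σ : ℕ → Permutation′ m) {i j} → 1 ≤ L → transport L σ i ≡ j →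
    SimplePath (Cross σ) (zero , i) (fromℕ L , j)
  transport⇒SimplePath {suc L} σ {i} (s≤s z≤n) refl with walkTail-last L σ i
  ... | zs , e = zs ,
    subst (λ ws → Linked (Cross σ) ((zero , i) ∷ ws)) e (walk-linked (suc L) σ i) ,
    subst (λ ws → Unique ((zero , i) ∷ ws)) e (walk-unique (suc L) σ i)

module CoverPermutation {V : Set} {E : V → V → Set} {m : ℕ} (H : FullCover V E m) where
  open FullCover H

  partner : ∀ {v v′} → E v v′ → v ≢ v′ → Fin m → Fin m
  partner e v≢v′ a = proj₁ (perfect _ _ e v≢v′ a)

  partner-unique : ∀ {v v′ a b} (e : E v v′) (v≢v′ : v ≢ v′) →
    adj (v , a) (v′ , b) ≡ true → partner e v≢v′ a ≡ b
  partner-unique e v≢v′ = matching _ _ _ _ _ e v≢v′ (proj₂ (perfect _ _ e v≢v′ _))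

  coverPermutation : ∀ {v v′} → E v v′ → E v′ v → v ≢ v′ → Permutation′ m
  coverPermutation e e′ v≢v′ = permutation (partner e v≢v′) (partner e′ (v≢v′ ∘ sym))
    (λ b → partner-unique e v≢v′ (trans (adj-sym _ _) (proj₂ (perfect _ _ e′ (v≢v′ ∘ sym) b))))
    (λ a → partner-unique e′ (v≢v′ ∘ sym) (trans (adj-sym _ _) (proj₂ (perfect _ _ e v≢v′ a))))

  coverPermutation⇔ : ∀ {v v′ a b} (e : E v v′) (e′ : E v′ v) (v≢v′ : v ≢ v′) →
    adj (v , a) (v′ , b) ≡ true ⇔ coverPermutation e e′ v≢v′ ⟨$⟩ʳ a ≡ b
  coverPermutation⇔ e e′ v≢v′ = mk⇔ (partner-unique e v≢v′) λ { refl → proj₂ (perfect _ _ e v≢v′ _) }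

module Positions {n : ℕ} {l : Fin (suc n) → ℕ} where

  pos-u⁻ : ∀ k t → pos {n} {l} k t ≡ u → t ≡ 0
  pos-u⁻ k zero _ = refl
  pos-u⁻ k (suc t) e with t <? l k ∸ 1
  pos-u⁻ k (suc t) () | yes _
  pos-u⁻ k (suc t) () | no _

  pos-w⁻ : ∀ k t → pos {n} {l} k t ≡ w → l k ≤ t
  pos-w⁻ k (suc t) e with t <? l k ∸ 1
  pos-w⁻ k (suc t) () | yes _
  pos-w⁻ k (suc t) e | no t≮ = ℕ.≤-trans (ℕ.m≤n+m∸n (l k) 1) (s≤s (ℕ.≮⇒≥ t≮))

  pos-int⁻ : ∀ k t {k′ x} → pos {n} {l} k t ≡ int k′ x → k ≡ k′ × t ≡ suc (toℕ x)
  pos-int⁻ k (suc t) e with t <? l k ∸ 1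
  pos-int⁻ k (suc t) refl | yes t< = refl , cong suc (sym (Fin.toℕ-fromℕ< t<))
  pos-int⁻ k (suc t) () | no _

  pos-l : ∀ k → 1 ≤ l k → pos {n} {l} k (l k) ≡ w
  pos-l k 1≤lk with l k in lk≡
  ... | suc t with t <? l k ∸ 1
  ...   | yes t< = ⊥-elim (ℕ.<-irrefl refl (ℕ.≤-trans t< (ℕ.≤-reflexive (cong (_∸ 1) lk≡))))
  ...   | no _ = refl

  pos-same : ∀ {k k′ t t′} → t ≤ l k → t′ ≤ l k′ → pos {n} {l} k t ≡ pos k′ t′ →
    (k ≡ k′ × t ≡ t′) ⊎ (t ≡ 0 × t′ ≡ 0) ⊎ (t ≡ l k × t′ ≡ l k′)
  pos-same {k} {k′} {t} {t′} t≤ t′≤ e = by-vertex (pos k′ t′) e refl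
    where
    by-vertex : ∀ v → pos {n} {l} k t ≡ v → pos k′ t′ ≡ v →
      (k ≡ k′ × t ≡ t′) ⊎ (t ≡ 0 × t′ ≡ 0) ⊎ (t ≡ l k × t′ ≡ l k′)
    by-vertex u e e′ = inj₂ (inj₁ (pos-u⁻ k t e , pos-u⁻ k′ t′ e′))
    by-vertex w e e′ = inj₂ (inj₂ (ℕ.≤-antisym t≤ (pos-w⁻ k t e) , ℕ.≤-antisym t′≤ (pos-w⁻ k′ t′ e′)))
    by-vertex (int _ x) e e′ with pos-int⁻ k t e | pos-int⁻ k′ t′ e′
    ... | refl , t≡ | refl , t′≡ = inj₁ (refl , trans t≡ (sym t′≡))

  pos-injective : ∀ {k t t′} → t ≤ l k → t′ ≤ l k → pos {n} {l} k t ≡ pos k t′ → t ≡ t′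
  pos-injective t≤ t′≤ e with pos-same t≤ t′≤ e
  ... | inj₁ (_ , t≡t′) = t≡t′
  ... | inj₂ (inj₁ (t≡0 , t′≡0)) = trans t≡0 (sym t′≡0)
  ... | inj₂ (inj₂ (t≡l , t′≡l)) = trans t≡l (sym t′≡l)

  pos-edge : ∀ {k k′ x y s} → x ≤ l k → y ≤ l k → s < l k′ →
    pos {n} {l} k x ≡ pos k′ s → pos k y ≡ pos k′ (suc s) → y ≡ suc x ⊎ (x ≡ 0 × y ≡ l k × l k′ ≡ 1)
  pos-edge x≤ y≤ s< ex ey with pos-same x≤ (ℕ.<⇒≤ s<) ex | pos-same y≤ s< ey
  ... | inj₁ (refl , refl) | inj₁ (_ , y≡) = inj₁ y≡
  ... | inj₁ (refl , refl) | inj₂ (inj₂ (y≡ , s+1≡)) = inj₁ (trans y≡ (sym s+1≡))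
  ... | inj₂ (inj₁ (refl , refl)) | inj₁ (_ , y≡) = inj₁ y≡
  ... | inj₂ (inj₁ (refl , refl)) | inj₂ (inj₂ (y≡ , s+1≡)) = inj₂ (refl , y≡ , sym s+1≡)
  ... | inj₂ (inj₂ (_ , s≡)) | _ = ⊥-elim (ℕ.<-irrefl s≡ s<)

  Ends : Fin (suc n) → ℕ → ℕ → Set
  Ends k x y = (x ≡ 0 × y ≡ l k) ⊎ (x ≡ l k × y ≡ 0)

  Ends-sym : ∀ {k x y} → Ends k x y → Ends k y x
  Ends-sym (inj₁ (x≡0 , y≡l)) = inj₂ (y≡l , x≡0)
  Ends-sym (inj₂ (x≡l , y≡0)) = inj₁ (y≡0 , x≡l)

  module _ (long : ∀ k → k ≢ zero → 2 ≤ l k) where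

    length-one : ∀ {k k′} → l k′ ≡ 1 → l k ≡ 1 ⊎ (l zero ≡ 1 × k ≢ zero)
    length-one {k} {k′} l≡1 with k′ ≟ zero
    ... | no k′≢0 = ⊥-elim (ℕ.<-irrefl (sym l≡1) (long k′ k′≢0))
    ... | yes refl with k ≟ zero
    ...   | yes refl = inj₁ l≡1
    ...   | no k≢0 = inj₂ (l≡1 , k≢0)

    pos-edge-or-ends : ∀ {k k′ x y s} → x ≤ l k → y ≤ l k → s < l k′ →
      pos {n} {l} k x ≡ pos k′ s → pos k y ≡ pos k′ (suc s) → y ≡ suc x ⊎ (Ends k x y × l zero ≡ 1 × k ≢ zero)
    pos-edge-or-ends x≤ y≤ s< ex ey with pos-edge x≤ y≤ s< ex ey
    ... | inj₁ y≡ = inj₁ y≡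
    ... | inj₂ (x≡0 , y≡l , l≡1) with length-one l≡1
    ...   | inj₁ lk≡1 = inj₁ (trans y≡l (trans lk≡1 (cong suc (sym x≡0))))
    ...   | inj₂ (l0≡1 , k≢0) = inj₂ (inj₁ (x≡0 , y≡l) , l0≡1 , k≢0)

    ThetaEdge-pos : ∀ {k x y} → x ≤ l k → y ≤ l k → ThetaEdge (pos {n} {l} k x) (pos k y) →
      y ≡ suc x ⊎ x ≡ suc y ⊎ (Ends k x y × l zero ≡ 1 × k ≢ zero)
    ThetaEdge-pos x≤ y≤ (_ , _ , s< , inj₁ (ex , ey)) with pos-edge-or-ends x≤ y≤ s< ex ey
    ... | inj₁ y≡ = inj₁ y≡
    ... | inj₂ ends = inj₂ (inj₂ ends)
    ThetaEdge-pos x≤ y≤ (_ , _ , s< , inj₂ (ex , ey)) with pos-edge-or-ends y≤ x≤ s< ey ex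
    ... | inj₁ x≡ = inj₂ (inj₁ x≡)
    ... | inj₂ (ends , l0≡1 , k≢0) = inj₂ (inj₂ (Ends-sym ends , l0≡1 , k≢0))

isU⇔ : ∀ {n l} {v : ThetaV n l} → isU v ≡ true ⇔ v ≡ u
isU⇔ {v = u} = mk⇔ (λ _ → refl) (λ _ → refl)
isU⇔ {v = w} = mk⇔ (λ ()) (λ ())
isU⇔ {v = int _ _} = mk⇔ (λ ()) (λ ())

isW⇔ : ∀ {n l} {v : ThetaV n l} → isW v ≡ true ⇔ v ≡ w
isW⇔ {v = u} = mk⇔ (λ ()) (λ ())
isW⇔ {v = w} = mk⇔ (λ _ → refl) (λ _ → refl)
isW⇔ {v = int _ _} = mk⇔ (λ ()) (λ ())

isFirst⇔ : ∀ {n} {k : Fin (suc n)} → not (isFirst k) ≡ true ⇔ k ≢ zero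
isFirst⇔ {k = zero} = mk⇔ (λ ()) (λ k≢0 → ⊥-elim (k≢0 refl))
isFirst⇔ {k = suc k} = mk⇔ (λ _ ()) (λ _ → refl)

module ThetaPath {n : ℕ} {l : Fin (suc n) → ℕ} (long : ∀ k → k ≢ zero → 2 ≤ l k)
                 {m : ℕ} (H : FullCover (ThetaV n l) ThetaEdge m) (k : Fin (suc n)) (1≤l : 1 ≤ l k) where
  open FullCover H
  open Positions {n} {l}
  open CoverPermutation H

  L : ℕ
  L = l k

  P : ℕ → ThetaV n l
  P = pos k

  isU-P⇔ : ∀ {x} → isU (P x) ≡ true ⇔ x ≡ 0
  isU-P⇔ {x} = mk⇔ (pos-u⁻ k x ∘ to isU⇔) (λ { refl → refl })

  isW-P⇔ : ∀ {x} → x ≤ L → isW (P x) ≡ true ⇔ x ≡ L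
  isW-P⇔ {x} x≤ = mk⇔ (λ isW → ℕ.≤-antisym x≤ (pos-w⁻ k x (to isW⇔ isW)))
                      (λ { refl → from isW⇔ (pos-l k 1≤l) })

  removed-true⁻ : ∀ {t a t′ b} → removed H k (t , a) (t′ , b) ≡ true →
    Ends k (toℕ t) (toℕ t′) × l zero ≡ 1 × k ≢ zero
  removed-true⁻ {t} {_} {t′} holds with ∧-true⁻ {l zero ≡ᵇ 1} holds
  ... | l0≡1 , rest with ∧-true⁻ {not (isFirst k)} rest
  ...   | k≢0 , ends = endpoints (∨-true⁻ ends) , ℕ.≡ᵇ⇒≡ _ _ (from T-≡ l0≡1) , to isFirst⇔ k≢0
    where
    endpoints : (isU (P (toℕ t)) ∧ isW (P (toℕ t′))) ≡ true ⊎ (isW (P (toℕ t)) ∧ isU (P (toℕ t′))) ≡ true →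
      Ends k (toℕ t) (toℕ t′)
    endpoints (inj₁ uw) with ∧-true⁻ {isU (P (toℕ t))} uw
    ... | t-u , t′-w = inj₁ (to isU-P⇔ t-u , to (isW-P⇔ (Fin.toℕ≤pred[n] t′)) t′-w)
    endpoints (inj₂ wu) with ∧-true⁻ {isW (P (toℕ t))} wu
    ... | t-w , t′-u = inj₂ (to (isW-P⇔ (Fin.toℕ≤pred[n] t)) t-w , to isU-P⇔ t′-u)

  removed-true⁺ : ∀ {t a t′ b} → Ends k (toℕ t) (toℕ t′) → l zero ≡ 1 → k ≢ zero →
    removed H k (t , a) (t′ , b) ≡ true
  removed-true⁺ {t} {_} {t′} ends l0≡1 k≢0 =
    ∧-true⁺ (to T-≡ (ℕ.≡⇒≡ᵇ _ _ l0≡1)) (∧-true⁺ (from isFirst⇔ k≢0) (∨-true⁺ (endpoints ends)))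
    where
    endpoints : Ends k (toℕ t) (toℕ t′) →
      (isU (P (toℕ t)) ∧ isW (P (toℕ t′))) ≡ true ⊎ (isW (P (toℕ t)) ∧ isU (P (toℕ t′))) ≡ true
    endpoints (inj₁ (t≡0 , t′≡L)) = inj₁ (∧-true⁺ (from isU-P⇔ t≡0) (from (isW-P⇔ (Fin.toℕ≤pred[n] t′)) t′≡L))
    endpoints (inj₂ (t≡L , t′≡0)) = inj₂ (∧-true⁺ (from (isW-P⇔ (Fin.toℕ≤pred[n] t)) t≡L) (from isU-P⇔ t′≡0))

  removed-same : ∀ {t a b} → removed H k (t , a) (t , b) ≡ false
  removed-same {t} {a} {b} = ¬-not λ holds → L≢0 (proj₁ (removed-true⁻ {t} {a} {t} {b} holds))
    where
    L≢0 : ∀ {x} → ¬ Ends k x x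
    L≢0 (inj₁ (x≡0 , x≡L)) = ℕ.<-irrefl (trans (sym x≡0) x≡L) 1≤l
    L≢0 (inj₂ (x≡L , x≡0)) = ℕ.<-irrefl (trans (sym x≡0) x≡L) 1≤l

  removed-next : ∀ {s : Fin L} {a b} → removed H k (inject₁ s , a) (suc s , b) ≡ false
  removed-next {s} {a} {b} = ¬-not λ holds → not-ends (removed-true⁻ {inject₁ s} {a} {suc s} {b} holds)
    where
    not-ends : ¬ (Ends k (toℕ (inject₁ s)) (suc (toℕ s)) × l zero ≡ 1 × k ≢ zero)
    not-ends (inj₁ (s≡0 , s+1≡L) , _ , k≢0) =
      ℕ.<-irrefl (trans (sym (cong suc (trans (sym (Fin.toℕ-inject₁ s)) s≡0))) s+1≡L) (long k k≢0)
    not-ends (inj₂ (_ , ()) , _)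

  adjHk-true⇔ : ∀ x y → adjHk H k x y ≡ true ⇔ (removed H k x y ≡ false × adj (vtx H k x) (vtx H k y) ≡ true)
  adjHk-true⇔ x y with removed H k x y
  ... | true = mk⇔ (λ ()) (λ ())
  ... | false = mk⇔ (refl ,_) proj₂

  adjHk-sym : ∀ x y → adjHk H k x y ≡ adjHk H k y x
  adjHk-sym (t , a) (t′ , b) = cong₂ (if_then false else_) removed-sym (adj-sym _ _)
    where
    U W : Fin (suc L) → Bool
    U = isU ∘ P ∘ toℕ
    W = isW ∘ P ∘ toℕ
    removed-sym : removed H k (t , a) (t′ , b) ≡ removed H k (t′ , b) (t , a)
    removed-sym = cong (λ ends → (l zero ≡ᵇ 1) ∧ not (isFirst k) ∧ ends)
      (trans (∨-comm (U t ∧ W t′) (W t ∧ U t′)) (cong₂ _∨_ (∧-comm (W t) (U t′)) (∧-comm (U t) (W t′))))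

  P-edge : ∀ {t} → t < L → ThetaEdge (P t) (P (suc t))
  P-edge t< = k , _ , t< , inj₁ (refl , refl)

  P-edge′ : ∀ {t} → t < L → ThetaEdge (P (suc t)) (P t)
  P-edge′ t< = k , _ , t< , inj₂ (refl , refl)

  P-step-≢ : ∀ {t} → t < L → P t ≢ P (suc t)
  P-step-≢ t< e = ℕ.1+n≢n (sym (pos-injective (ℕ.<⇒≤ t<) t< e))

  -- beyond the end of the path the matchings are never used; they are set to the identity
  σ : ℕ → Permutation′ m
  σ t with t <? L
  ... | yes t< = coverPermutation (P-edge t<) (P-edge′ t<) (P-step-≢ t<)
  ... | no _ = Perm.id

  σ⇔ : ∀ {t a b} → t < L → adj (P t , a) (P (suc t) , b) ≡ true ⇔ σ t ⟨$⟩ʳ a ≡ b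
  σ⇔ {t} t< with t <? L
  ... | yes t<′ = coverPermutation⇔ (P-edge t<′) (P-edge′ t<′) (P-step-≢ t<′)
  ... | no t≮ = ⊥-elim (t≮ t<)

  adjHk-same⇔ : ∀ t a b → adjHk H k (t , a) (t , b) ≡ true ⇔ a ≢ b
  adjHk-same⇔ t a b = mk⇔ (λ holds → irreflexive (proj₂ (to (adjHk-true⇔ (t , a) (t , b)) holds)))
    (λ a≢b → from (adjHk-true⇔ (t , a) (t , b)) (removed-same {t} {a} {b} , clique _ _ _ a≢b))
    where
    irreflexive : ∀ {v a b} → adj (v , a) (v , b) ≡ true → a ≢ b
    irreflexive holds refl with trans (sym holds) (adj-irr _)
    ... | ()

  adjHk-next⇔ : ∀ (s : Fin L) a b → adjHk H k (inject₁ s , a) (suc s , b) ≡ true ⇔ σ (toℕ s) ⟨$⟩ʳ a ≡ b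
  adjHk-next⇔ s a b = mk⇔
    (λ holds → to (σ⇔ (Fin.toℕ<n s)) (subst adjacent (Fin.toℕ-inject₁ s) (proj₂ (to (adjHk-true⇔ x y) holds))))
    (λ σa≡b → from (adjHk-true⇔ x y) (removed-next {s} {a} {b} ,
                 subst adjacent (sym (Fin.toℕ-inject₁ s)) (from (σ⇔ (Fin.toℕ<n s)) σa≡b)))
    where
    x y : Fin (suc L) × Fin m
    x = inject₁ s , a
    y = suc s , b
    adjacent : ℕ → Set
    adjacent t = adj (P t , a) (P (suc (toℕ s)) , b) ≡ true

  adjHk-apart : ∀ {t a t′ b} → toℕ t ≢ toℕ t′ → toℕ t′ ≢ suc (toℕ t) → toℕ t ≢ suc (toℕ t′) →
    adjHk H k (t , a) (t′ , b) ≢ true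
  adjHk-apart {t} {a} {t′} {b} t≢t′ t′≢t+1 t≢t′+1 holds
    with to (adjHk-true⇔ (t , a) (t′ , b)) holds
  ... | kept , adjacent
    with ThetaEdge-pos long (Fin.toℕ≤pred[n] t) (Fin.toℕ≤pred[n] t′) (cross⇒E _ _ a b P≢ adjacent)
    where
    P≢ : P (toℕ t) ≢ P (toℕ t′)
    P≢ = t≢t′ ∘ pos-injective (Fin.toℕ≤pred[n] t) (Fin.toℕ≤pred[n] t′)
  ...   | inj₁ t′≡t+1 = t′≢t+1 t′≡t+1
  ...   | inj₂ (inj₁ t≡t′+1) = t≢t′+1 t≡t′+1
  ...   | inj₂ (inj₂ (ends , l0≡1 , k≢0)) with trans (sym (removed-true⁺ {t} {a} {t′} {b} ends l0≡1 k≢0)) kept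
  ...     | ()

  adjHk⇔Adjacent : ∀ x y → adjHk H k x y ≡ true ⇔ Adjacent σ x y
  adjHk⇔Adjacent (t , a) (t′ , b) = mk⇔ (sound (relative t t′)) complete
    where
    sound : Relative t t′ → adjHk H k (t , a) (t′ , b) ≡ true → Adjacent σ (t , a) (t′ , b)
    sound same holds = within (to (adjHk-same⇔ t a b) holds)
    sound (next s) holds = cross (forward s (to (adjHk-next⇔ s a b) holds))
    sound (prev s) holds =
      cross (backward s (to (adjHk-next⇔ s b a) (trans (adjHk-sym (t′ , b) (t , a)) holds)))
    sound (apart t≢t′ t′≢t+1 t≢t′+1) holds = ⊥-elim (adjHk-apart t≢t′ t′≢t+1 t≢t′+1 holds)
    complete : ∀ {x y} → Adjacent σ x y → adjHk H k x y ≡ true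
    complete (within {t} {a} {b} a≢b) = from (adjHk-same⇔ t a b) a≢b
    complete (cross (forward s {a} {b} σa≡b)) = from (adjHk-next⇔ s a b) σa≡b
    complete (cross (backward s {a} {b} σa≡b)) =
      trans (adjHk-sym (suc s , b) (inject₁ s , a)) (from (adjHk-next⇔ s a b) σa≡b)

  CrossEdge⇔Cross : ∀ x y → CrossEdge H k x y ⇔ Cross σ x y
  CrossEdge⇔Cross x y = mk⇔ sound complete
    where
    sound : CrossEdge H k x y → Cross σ x y
    sound (holds , P≢) with to (adjHk⇔Adjacent x y) holds
    ... | within _ = ⊥-elim (P≢ refl)
    ... | cross c = c
    complete : Cross σ x y → CrossEdge H k x y
    complete c = from (adjHk⇔Adjacent x y) (cross c) ,
      Cross⇒levels≢ c ∘ pos-injective (Fin.toℕ≤pred[n] (proj₁ x)) (Fin.toℕ≤pred[n] (proj₁ y))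

mainTheorem5 : (n : ℕ) → 1 ≤ n → (l : Fin (suc n) → ℕ) →
    1 ≤ l zero → (∀ k → k ≢ zero → 2 ≤ l k) → (∀ k → l zero ≤ l k) →
    (m : ℕ) → 2 ≤ m → (H : FullCover (ThetaV n l) ThetaEdge m) →
    (i j : Fin m) → (k : Fin (suc n)) →
    (CrossPath H k (zero , i) (fromℕ (l k) , j) →
      + m * + N₂ H k (zero , i) (fromℕ (l k) , j)
        ≡ (+ m - + 1) ^ l k + (- + 1) ^ l k * (+ m - + 1))
    × (¬ CrossPath H k (zero , i) (fromℕ (l k) , j) →
      + m * + N₂ H k (zero , i) (fromℕ (l k) , j)
        ≡ (+ m - + 1) ^ l k - (- + 1) ^ l k)
mainTheorem5 n _ l 1≤l₀ long l₀-shortest m _ H i j k =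
  (λ path → trans count (#colourings-aligned L σ i (to path⇔ path))) ,
  (λ ¬path → trans count (#colourings-misaligned L σ i (¬path ∘ from path⇔)))
  where
  1≤l : 1 ≤ l k
  1≤l = ℕ.≤-trans 1≤l₀ (l₀-shortest k)
  open ThetaPath long H k 1≤l
  open Independence σ (adjHk H k) adjHk⇔Adjacent
  open Colourings j
  count : + m * + N₂ H k (zero , i) (fromℕ L , j) ≡ + m * + #colourings L σ i
  count = cong (λ N → + m * + N) (#colouringsThrough≡#colourings i j)
  path⇔ : CrossPath H k (zero , i) (fromℕ L , j) ⇔ (transport L σ i ≡ j)
  path⇔ = mk⇔
    (SimplePath⇒transport σ i ∘ SimplePath-map (to (CrossEdge⇔Cross _ _)))
    (SimplePath-map (from (CrossEdge⇔Cross _ _)) ∘ transport⇒SimplePath σ 1≤l)
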